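{- Let $p\ge 3$, $k\in\{0,\dots,p\}$ and $i\in\{1,\dots,p\}$. Then \[ \sum_{\substack{x\in M_p^k\\ x_i=p}} t^{\mathrm{rk}(x)}= \begin{cases} t^{i-1}\,\zeta(P(\mathcal{D}_{p-1}^{k},B_{p-1}),t) & \text{if } i\le p-k,\\ t^{i-1}\,\zeta(P(\mathcal{D}_{p-1}^{k-1},B_{p-1}),t) & \text{if } i>p-k,\end{cases} \] and \[ \sum_{\substack{x\in M_p^k\\ x_i=-p}} t^{\mathrm{rk}(x)}= \begin{cases} t^{2p-i-1}\,\zeta(P(\mathcal{D}_{p-1}^{k},B_{p-1}),t) & \text{if } i\le p-k,\\ t^{2p-i}\,\zeta(P(\mathcal{D}_{p-1}^{k-1},B_{p-1}),t) & \text{if } i>p-k.\end{cases} \]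
   Context: For integers $0\le k\le p$, $\mathcal{D}_p^k$ is the arrangement in $\mathbb{R}^p$ with defining polynomial $x_{p-k+1}\cdots x_p\prod_{1\le i<j\le p}(x_i^2-x_j^2)$, i.e. its hyperplanes are $\ker(x_i-x_j)$ and $\ker(x_i+x_j)$ for $1\le i<j\le p$, and $\ker(x_i)$ for $p-k<i\le p$. Let $M_p^k$ be the set of $x=(x_1,\dots,x_p)\in\{\pm1,\dots,\pm p\}^p$ such that $x_1,\dots,x_{p-k}\ne -1$ and $|x_i|\neq|x_j|$ for all $i\ne j$; each region of $\mathcal{D}_p^k$ (connected component of the complement of the union of its hyperplanes) contains exactly one point of $M_p^k$. Let $B_p$ be the region of $\mathcal{D}_p^k$ containing $(p,p-1,\dots,1)$. For $x\in M_p^k$, $\mathrm{rk}(x)$ denotes the number of hyperplanes of $\mathcal{D}_p^k$ separating $B_p$ from the region containing $x$. For an arrangement $\mathcal{A}$ with base region $B$, $\zeta(P(\mathcal{A},B),t)=\sum_R t^{\mathrm{rk}(R)}$, summing over all regions $R$, where $\mathrm{rk}(R)$ is the number of hyperplanes of $\mathcal{A}$ separating $B$ and $R$; here $B_{p-1}$ is the region of $\mathcal{D}_{p-1}^{k'}$ containing $(p-1,p-2,\dots,1)$. -}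

module Defs where

open import Data.Nat using (ℕ; zero; suc; _+_; _∸_; _≤ᵇ_; _≡ᵇ_)
open import Data.Integer using (ℤ; +_; -[1+_]; ∣_∣) renaming (_+_ to _+ℤ_)
import Data.Integer as ℤ
open import Data.Bool using (Bool; true; false; _∧_; _∨_; not; if_then_else_)
open import Data.List using (List; []; _∷_; map; concatMap; filter; upTo; length; _++_; allFin; sum)
open import Data.Vec using (Vec; []; _∷_; lookup)
open import Data.Fin using (Fin; toℕ)
open import Data.Product using (_×_; _,_; proj₁; proj₂)
open import Relation.Nullary.Decidable using (⌊_⌋; T?)

-- Polynomials in t with natural coefficients, represented by their
-- coefficient function: (f r) is the coefficient of t^r.
Poly : Set
Poly = ℕ → ℕ

shift : ℕ → Poly → Poly
shift a f r = if a ≤ᵇ r then f (r ∸ a) else 0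

infix 4 _<ℤ_ _==ℤ_
_<ℤ_ : ℤ → ℤ → Bool
x <ℤ y = ⌊ x ℤ.<? y ⌋

_==ℤ_ : ℤ → ℤ → Bool
x ==ℤ y = ⌊ x ℤ.≟ y ⌋

vals : ℕ → List ℤ
vals p = map (λ n → + suc n) (upTo p) ++ map -[1+_] (upTo p)

allVecs : (m : ℕ) → List ℤ → List (Vec ℤ m)
allVecs zero    vs = [] ∷ []
allVecs (suc m) vs = concatMap (λ v → map (v ∷_) (allVecs m vs)) vs

-- 1-based entry: at x i = x_i (default 0 outside 1..p, never used)
at : ∀ {p} → Vec ℤ p → ℕ → ℤ
at {p} x i = go (allFin p)
  where
  go : List (Fin p) → ℤ
  go []       = + 0
  go (j ∷ js) = if suc (toℕ j) ≡ᵇ i then lookup x j else go js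

count : ∀ {A : Set} → (A → Bool) → List A → ℕ
count P xs = length (filter (λ a → T? (P a)) xs)

idx : ℕ → List ℕ
idx p = map suc (upTo p)

pairs : ℕ → List (ℕ × ℕ)
pairs p = concatMap (λ i → map (i ,_) (filter (λ j → T? (suc i ≤ᵇ j)) (idx p))) (idx p)

-- membership in M_p^k : x_1,…,x_{p-k} ≠ -1 and |x_i| ≠ |x_j| for i ≠ j
-- (entries already range over {±1,…,±p})
isM : (p k : ℕ) → Vec ℤ p → Bool
isM p k x =
  all? (λ i → not (at x i ==ℤ -[1+ 0 ])) (filter (λ i → T? (i ≤ᵇ (p ∸ k))) (idx p))
  ∧ all? (λ ij → not (∣ at x (proj₁ ij) ∣ ≡ᵇ ∣ at x (proj₂ ij) ∣)) (pairs p)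
  where
  all? : {A : Set} → (A → Bool) → List A → Bool
  all? P []       = true
  all? P (a ∷ as) = P a ∧ all? P as

M : (p k : ℕ) → List (Vec ℤ p)
M p k = filter (λ x → T? (isM p k x)) (allVecs p (vals p))

-- rk(x): number of hyperplanes of D_p^k separating the base region B_p
-- (containing (p,…,1), where every defining form x_i - x_j, x_i + x_j (i<j)
-- and x_i is positive) from the region containing x.
rk : (p k : ℕ) → Vec ℤ p → ℕ
rk p k x =
    count (λ ij → at x (proj₁ ij) <ℤ at x (proj₂ ij)) (pairs p)
  + count (λ ij → (at x (proj₁ ij) +ℤ at x (proj₂ ij)) <ℤ (+ 0)) (pairs p)
  + count (λ i → at x i <ℤ (+ 0)) (filter (λ i → T? (suc (p ∸ k) ≤ᵇ i)) (idx p))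

genPoly : ∀ {p} → (Vec ℤ p → ℕ) → List (Vec ℤ p) → Poly
genPoly r xs n = count (λ x → r x ≡ᵇ n) xs

-- ζ(P(D_p^k, B_p), t) : regions enumerated by their unique representatives in M_p^k
zeta : (p k : ℕ) → Poly
zeta p k = genPoly (rk p k) (M p k)

restricted : (p k i : ℕ) → ℤ → Poly
restricted p k i v = genPoly (rk p k) (filter (λ x → T? (at x i ==ℤ v)) (M p k))

{-# OPTIONS --safe #-}
module Submission where

-- A vector x ∈ M_p^k with x_i = ±p arises from exactly one
-- y ∈ {±1,…,±(p-1)}^(p-1) by inserting ±p at position i, and x ∈ M_p^k iff
-- y ∈ M_(p-1)^k′, where k′ = k when position i is among the first p-k coordinates
-- (which must avoid -1, so p ≥ 2 is needed for -p) and k′ = k-1 when x_i = 0 is a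
-- hyperplane. As every |y_j| < p, the new coordinate lies on a fixed side of each
-- hyperplane through it: for +p exactly the i-1 forms x_a - x_i (a < i) are negative;
-- for -p the p-i forms x_i - x_b (b > i), all p-1 forms x_a + x_b through i, and x_i
-- itself when it is a hyperplane. Hence rk x = c + rk y with c depending only on i,
-- and the sum is t^c ζ(P(D_(p-1)^k′, B_(p-1)), t).

open import Defs
open import Data.Nat using (ℕ; _≤_; _<_; _∸_; _+_; _*_)
open import Data.Integer using (+_; -_)
open import Data.Product using (_×_)
open import Relation.Binary.PropositionalEquality using (_≡_)

open import Algebra.Bundles using (CommutativeMonoid)
open import Data.Bool using (Bool; true; false; T; _∧_; not; if_then_else_)
import Data.Bool.Properties as Bool
open import Data.Empty using (⊥-elim)
open import Data.Fin using (Fin; toℕ; fromℕ<)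
import Data.Fin as Fin
open import Data.Fin.Properties using (toℕ<n; toℕ≤pred[n]; toℕ-fromℕ<)
open import Data.Integer using (ℤ; -[1+_]; ∣_∣) renaming (_+_ to _+ℤ_)
import Data.Integer as ℤ
import Data.Integer.Properties as ℤₚ
open import Data.Bool.ListAction using (and; all)
open import Data.List using (List; []; _∷_; [_]; _++_; map; filter; concatMap; take; drop; upTo; allFin; foldr; length)
import Data.List.Properties as List
open import Data.List.Relation.Unary.All using (All; []; _∷_)
import Data.List.Relation.Unary.All as All
import Data.List.Relation.Unary.All.Properties as All
open import Data.Nat using (zero; suc; _≡ᵇ_; _<ᵇ_; _≤ᵇ_; z≤n; s≤s; s≤s⁻¹)
open import Data.Nat.ListAction using (sum)
import Data.Nat.Properties as ℕ
open import Data.Nat.Tactic.RingSolver using (solve-∀)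
open import Data.Product using (_,_; proj₁; proj₂; uncurry) renaming (map to map×)
open import Data.Unit using (tt)
open import Data.Vec using (Vec; []; _∷_; lookup; insertAt; toList)
open import Data.Vec.Properties using (length-toList)
open import Function using (_∘_; id)
open import Relation.Binary.PropositionalEquality using (_≢_; refl; sym; trans; cong; cong₂; subst; module ≡-Reasoning)
open import Relation.Nullary using (¬_; Dec; contradiction)
open import Relation.Nullary.Decidable using (T?; isYes≗does; dec-true; dec-false; toWitness)

open import Algebra.Properties.CommutativeSemigroup (CommutativeMonoid.commutativeSemigroup Bool.∧-commutativeMonoid)
  using () renaming (x∙yz≈y∙xz to ∧-swap; interchange to ∧-interchange)
open import Algebra.Properties.CommutativeSemigroup ℕ.+-commutativeSemigroup
  using () renaming (x∙yz≈y∙xz to +-swap)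

private variable
  A B : Set
  m : ℕ

indicator : Bool → ℕ
indicator true  = 1
indicator false = 0

tally : (A → Bool) → List A → ℕ
tally P []       = 0
tally P (a ∷ as) = indicator (P a) + tally P as

count≡tally : (P : A → Bool) (xs : List A) → count P xs ≡ tally P xs
count≡tally P []       = refl
count≡tally P (a ∷ as) with P a
... | true  = cong suc (count≡tally P as)
... | false = count≡tally P as

tally-filter : (Q P : A → Bool) (xs : List A) → tally P (filter (T? ∘ Q) xs) ≡ tally (λ a → Q a ∧ P a) xs
tally-filter Q P []       = refl
tally-filter Q P (a ∷ as) with Q a
... | true  = cong (_+_ (indicator (P a))) (tally-filter Q P as)
... | false = tally-filter Q P as

tally-cong : {P Q : A → Bool} {xs : List A} → All (λ a → P a ≡ Q a) xs → tally P xs ≡ tally Q xs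
tally-cong []       = refl
tally-cong (e ∷ es) = cong₂ _+_ (cong indicator e) (tally-cong es)

tally-const : {P : A → Bool} {b : Bool} {xs : List A} → All (λ a → P a ≡ b) xs → tally P xs ≡ length xs * indicator b
tally-const []       = refl
tally-const (e ∷ es) = cong₂ _+_ (cong indicator e) (tally-const es)

tally-false : {P : A → Bool} {xs : List A} → All (λ a → P a ≡ false) xs → tally P xs ≡ 0
tally-false {xs = xs} es = trans (tally-const es) (ℕ.*-zeroʳ (length xs))

tally-++ : (P : A → Bool) (xs ys : List A) → tally P (xs ++ ys) ≡ tally P xs + tally P ys
tally-++ P []       ys = refl
tally-++ P (a ∷ as) ys = trans (cong (_+_ (indicator (P a))) (tally-++ P as ys)) (sym (ℕ.+-assoc (indicator (P a)) _ _))

tally-map : (P : B → Bool) (f : A → B) (xs : List A) → tally P (map f xs) ≡ tally (P ∘ f) xs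
tally-map P f []       = refl
tally-map P f (a ∷ as) = cong (_+_ (indicator (P (f a)))) (tally-map P f as)

tally-concatMap : (P : B → Bool) (f : A → List B) (xs : List A) → tally P (concatMap f xs) ≡ sum (map (tally P ∘ f) xs)
tally-concatMap P f []       = refl
tally-concatMap P f (a ∷ as) = trans (tally-++ P (f a) (concatMap f as)) (cong (_+_ (tally P (f a))) (tally-concatMap P f as))

sum-map-filter : (Q : A → Bool) (h : A → ℕ) (xs : List A) → sum (map h (filter (T? ∘ Q) xs)) ≡ sum (map (λ a → if Q a then h a else 0) xs)
sum-map-filter Q h []       = refl
sum-map-filter Q h (a ∷ as) with Q a
... | true  = cong (_+_ (h a)) (sum-map-filter Q h as)
... | false = sum-map-filter Q h as

sum-map-if : (Q : A → Bool) (n : ℕ) (xs : List A) → sum (map (λ a → if Q a then n else 0) xs) ≡ tally Q xs * n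
sum-map-if Q n []       = refl
sum-map-if Q n (a ∷ as) with Q a
... | true  = cong (_+_ n) (sum-map-if Q n as)
... | false = sum-map-if Q n as

count-map : (P : B → Bool) (f : A → B) (xs : List A) → count (P ∘ f) xs ≡ tally P (map f xs)
count-map P f xs = trans (count≡tally (P ∘ f) xs) (sym (tally-map P f xs))

all-map : (P : B → Bool) (f : A → B) (xs : List A) → all P (map f xs) ≡ all (P ∘ f) xs
all-map P f xs = cong and (sym (List.map-∘ xs))

all-++ : (P : A → Bool) (xs ys : List A) → all P (xs ++ ys) ≡ all P xs ∧ all P ys
all-++ P []       ys = refl
all-++ P (a ∷ as) ys = trans (cong (P a ∧_) (all-++ P as ys)) (sym (Bool.∧-assoc (P a) _ _))

all-universal : (P : A → Bool) (h : List A → Bool) → h [] ≡ true → (∀ a as → h (a ∷ as) ≡ P a ∧ h as) → ∀ as → h as ≡ all P as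
all-universal P h base step as =
  trans (List.foldr-universal h (λ a → P a ∧_) true base step as)
        (sym (List.foldr-universal (all P) (λ a → P a ∧_) true refl (λ _ _ → refl) as))

filter-map : (P : B → Bool) (f : A → B) (xs : List A) → filter (T? ∘ P) (map f xs) ≡ map f (filter (T? ∘ P ∘ f) xs)
filter-map P f []       = refl
filter-map P f (a ∷ as) with P (f a)
... | true  = cong (f a ∷_) (filter-map P f as)
... | false = filter-map P f as

genPoly-+ : ∀ {p} (f : Vec ℤ p → ℕ) (xs : List (Vec ℤ p)) c r → genPoly (λ x → c + f x) xs r ≡ shift c (genPoly f xs) r
genPoly-+ f xs zero          r       = refl
genPoly-+ f xs (suc c)       zero    = trans (count≡tally _ xs) (tally-false (All.universal (λ _ → refl) xs))
genPoly-+ f xs (suc zero)    (suc r) = refl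
genPoly-+ f xs (suc (suc c)) (suc r) = genPoly-+ f xs (suc c) r

≡ᵇ-sym : ∀ m n → (m ≡ᵇ n) ≡ (n ≡ᵇ m)
≡ᵇ-sym zero    zero    = refl
≡ᵇ-sym zero    (suc n) = refl
≡ᵇ-sym (suc m) zero    = refl
≡ᵇ-sym (suc m) (suc n) = ≡ᵇ-sym m n

≡ᵇ-refl : ∀ n → (n ≡ᵇ n) ≡ true
≡ᵇ-refl zero    = refl
≡ᵇ-refl (suc n) = ≡ᵇ-refl n

≢⇒≡ᵇ≡false : ∀ {m n} → m ≢ n → (m ≡ᵇ n) ≡ false
≢⇒≡ᵇ≡false {m} {n} m≢n with m ≡ᵇ n in eq
... | true  = ⊥-elim (m≢n (ℕ.≡ᵇ⇒≡ m n (subst T (sym eq) tt)))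
... | false = refl

==ℤ⇒≡ : ∀ {x y} → (x ==ℤ y) ≡ true → x ≡ y
==ℤ⇒≡ {x} {y} eq = toWitness {a? = x ℤ.≟ y} (subst T (sym eq) tt)

==ℤ-refl : ∀ x → (x ==ℤ x) ≡ true
==ℤ-refl x = trans (isYes≗does (x ℤ.≟ x)) (dec-true (x ℤ.≟ x) refl)

≢⇒==ℤ≡false : ∀ {x y} → x ≢ y → (x ==ℤ y) ≡ false
≢⇒==ℤ≡false {x} {y} x≢y = trans (isYes≗does (x ℤ.≟ y)) (dec-false (x ℤ.≟ y) x≢y)

<⇒<ℤ≡true : ∀ {x y} → x ℤ.< y → (x <ℤ y) ≡ true
<⇒<ℤ≡true {x} {y} x<y = trans (isYes≗does (x ℤ.<? y)) (dec-true (x ℤ.<? y) x<y)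

≮⇒<ℤ≡false : ∀ {x y} → ¬ x ℤ.< y → (x <ℤ y) ≡ false
≮⇒<ℤ≡false {x} {y} x≮y = trans (isYes≗does (x ℤ.<? y)) (dec-false (x ℤ.<? y) x≮y)

pick : ∀ {p} → Vec ℤ p → ℕ → Fin p → ℤ → ℤ
pick x i j r = if suc (toℕ j) ≡ᵇ i then lookup x j else r

-- `at` searches allFin p with a function local to its definition; abstracting
-- allFin p lets foldr-universal identify that function.
at≡foldr : ∀ {p} (x : Vec ℤ p) i → at x i ≡ foldr (pick x i) (+ 0) (allFin p)
at≡foldr {p} x i with allFin p | List.foldr-universal _ (pick x i) (+ 0) refl (λ _ _ → refl)
... | js | search≗foldr = search≗foldr js

at-head : ∀ h (x : Vec ℤ m) → at (h ∷ x) 1 ≡ h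
at-head h x = at≡foldr (h ∷ x) 1

at-tail : ∀ h (x : Vec ℤ m) a → at (h ∷ x) (suc (suc a)) ≡ at x (suc a)
at-tail {m} h x a =
  trans (at≡foldr (h ∷ x) (suc (suc a)))
  (trans (cong (foldr (pick (h ∷ x) (suc (suc a))) (+ 0)) (sym (List.map-tabulate id Fin.suc)))
  (trans (List.foldr-map (pick (h ∷ x) (suc (suc a))) Fin.suc (+ 0) (allFin m))
         (sym (at≡foldr x (suc a)))))

at-lookup : (x : Vec ℤ m) (j : Fin m) → at x (suc (toℕ j)) ≡ lookup x j
at-lookup (h ∷ x) Fin.zero    = at-head h x
at-lookup (h ∷ x) (Fin.suc j) = trans (at-tail h x (toℕ j)) (at-lookup x j)

upTo-suc : ∀ n → upTo (suc n) ≡ 0 ∷ map suc (upTo n)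
upTo-suc n = cong (0 ∷_) (sym (List.map-applyUpTo id suc n))

toList≡map-at : (x : Vec ℤ m) → toList x ≡ map (at x) (idx m)
toList≡map-at x = trans (entries x) (List.map-∘ (upTo _))
  where
  entries : (x : Vec ℤ m) → toList x ≡ map (λ a → at x (suc a)) (upTo m)
  entries []          = refl
  entries {suc m} (h ∷ x) = begin
    h ∷ toList x                                                ≡⟨ cong₂ _∷_ (sym (at-head h x)) (entries x) ⟩
    at (h ∷ x) 1 ∷ map (λ a → at x (suc a)) (upTo m)            ≡⟨ cong (_ ∷_) (List.map-cong (λ a → sym (at-tail h x a)) (upTo m)) ⟩
    at (h ∷ x) 1 ∷ map (λ a → at (h ∷ x) (suc (suc a))) (upTo m) ≡⟨ cong (_ ∷_) (List.map-∘ (upTo m)) ⟩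
    map (λ a → at (h ∷ x) (suc a)) (0 ∷ map suc (upTo m))       ≡⟨ cong (map _) (sym (upTo-suc m)) ⟩
    map (λ a → at (h ∷ x) (suc a)) (upTo (suc m))               ∎
    where open ≡-Reasoning

upTo-take : ∀ n d → filter (T? ∘ (_<ᵇ d)) (upTo n) ≡ take d (upTo n)
upTo-take zero    zero    = refl
upTo-take zero    (suc d) = refl
upTo-take (suc n) zero    = begin
  filter (T? ∘ (_<ᵇ 0)) (upTo (suc n))            ≡⟨ cong (filter (T? ∘ (_<ᵇ 0))) (upTo-suc n) ⟩
  filter (T? ∘ (_<ᵇ 0)) (map suc (upTo n))        ≡⟨ filter-map (_<ᵇ 0) suc (upTo n) ⟩
  map suc (filter (T? ∘ (_<ᵇ 0) ∘ suc) (upTo n))  ≡⟨ cong (map suc) (List.filter-none (T? ∘ (_<ᵇ 0) ∘ suc) (All.universal (λ _ ()) (upTo n))) ⟩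
  []                                              ∎
  where open ≡-Reasoning
upTo-take (suc n) (suc d) = begin
  filter (T? ∘ (_<ᵇ suc d)) (upTo (suc n))        ≡⟨ cong (filter (T? ∘ (_<ᵇ suc d))) (upTo-suc n) ⟩
  0 ∷ filter (T? ∘ (_<ᵇ suc d)) (map suc (upTo n)) ≡⟨ cong (0 ∷_) (filter-map (_<ᵇ suc d) suc (upTo n)) ⟩
  0 ∷ map suc (filter (T? ∘ (_<ᵇ d)) (upTo n))    ≡⟨ cong (λ as → 0 ∷ map suc as) (upTo-take n d) ⟩
  0 ∷ map suc (take d (upTo n))                   ≡⟨ cong (0 ∷_) (sym (List.take-map d (upTo n))) ⟩
  take (suc d) (0 ∷ map suc (upTo n))             ≡⟨ cong (take (suc d)) (upTo-suc n) ⟨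
  take (suc d) (upTo (suc n))                     ∎
  where open ≡-Reasoning

upTo-drop : ∀ n d → filter (T? ∘ (d <ᵇ_) ∘ suc) (upTo n) ≡ drop d (upTo n)
upTo-drop n       zero    = List.filter-all (T? ∘ (0 <ᵇ_) ∘ suc) (All.universal (λ _ → tt) (upTo n))
upTo-drop zero    (suc d) = refl
upTo-drop (suc n) (suc d) = begin
  filter (T? ∘ (suc d <ᵇ_) ∘ suc) (upTo (suc n))        ≡⟨ cong (filter (T? ∘ (suc d <ᵇ_) ∘ suc)) (upTo-suc n) ⟩
  filter (T? ∘ (suc d <ᵇ_) ∘ suc) (map suc (upTo n))    ≡⟨ filter-map ((suc d <ᵇ_) ∘ suc) suc (upTo n) ⟩
  map suc (filter (T? ∘ (d <ᵇ_) ∘ suc) (upTo n))        ≡⟨ cong (map suc) (upTo-drop n d) ⟩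
  map suc (drop d (upTo n))                             ≡⟨ List.drop-map d (upTo n) ⟨
  drop (suc d) (0 ∷ map suc (upTo n))                   ≡⟨ cong (drop (suc d)) (upTo-suc n) ⟨
  drop (suc d) (upTo (suc n))                           ∎
  where open ≡-Reasoning

idx-suc : ∀ n → idx (suc n) ≡ 1 ∷ map suc (idx n)
idx-suc n = cong (map suc) (upTo-suc n)

idx-take : ∀ n d → filter (λ i → T? (i ≤ᵇ d)) (idx n) ≡ take d (idx n)
idx-take n d = trans (filter-map (_≤ᵇ d) suc (upTo n))
  (trans (cong (map suc) (upTo-take n d)) (sym (List.take-map d (upTo n))))

idx-drop : ∀ n d → filter (λ i → T? (suc d ≤ᵇ i)) (idx n) ≡ drop d (idx n)
idx-drop n d = trans (filter-map (suc d ≤ᵇ_) suc (upTo n))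
  (trans (cong (map suc) (upTo-drop n d)) (sym (List.drop-map d (upTo n))))

map-at-take : (x : Vec ℤ m) (d : ℕ) → map (at x) (filter (λ i → T? (i ≤ᵇ d)) (idx m)) ≡ take d (toList x)
map-at-take {m} x d = trans (cong (map (at x)) (idx-take m d))
  (trans (sym (List.take-map d (idx m))) (cong (take d) (sym (toList≡map-at x))))

map-at-drop : (x : Vec ℤ m) (d : ℕ) → map (at x) (filter (λ i → T? (suc d ≤ᵇ i)) (idx m)) ≡ drop d (toList x)
map-at-drop {m} x d = trans (cong (map (at x)) (idx-drop m d))
  (trans (sym (List.drop-map d (idx m))) (cong (drop d) (sym (toList≡map-at x))))

pairsOf : List A → List (A × A)
pairsOf []       = []
pairsOf (a ∷ as) = map (a ,_) as ++ pairsOf as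

map-pair : (f : A → B) (a : A) (xs : List A) → map (map× f f) (map (a ,_) xs) ≡ map (f a ,_) (map f xs)
map-pair f a xs = trans (sym (List.map-∘ xs)) (List.map-∘ xs)

map-pairsOf : (f : A → B) (xs : List A) → map (map× f f) (pairsOf xs) ≡ pairsOf (map f xs)
map-pairsOf f []       = refl
map-pairsOf f (a ∷ as) = trans (List.map-++ (map× f f) (map (a ,_) as) (pairsOf as)) (cong₂ _++_ (map-pair f a as) (map-pairsOf f as))

pairsOf-idx : ∀ n → pairsOf (idx n) ≡ concatMap (λ i → map (i ,_) (drop i (idx n))) (idx n)
pairsOf-idx zero    = refl
pairsOf-idx (suc n) = begin
  pairsOf (idx (suc n))
    ≡⟨ cong pairsOf (idx-suc n) ⟩
  map (1 ,_) (map suc (idx n)) ++ pairsOf (map suc (idx n))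
    ≡⟨ cong (map (1 ,_) (map suc (idx n)) ++_) (begin
         pairsOf (map suc (idx n))
           ≡⟨ map-pairsOf suc (idx n) ⟨
         map (map× suc suc) (pairsOf (idx n))
           ≡⟨ cong (map (map× suc suc)) (pairsOf-idx n) ⟩
         map (map× suc suc) (concatMap (λ i → map (i ,_) (drop i (idx n))) (idx n))
           ≡⟨ List.map-concatMap (map× suc suc) _ (idx n) ⟩
         concatMap (λ i → map (map× suc suc) (map (i ,_) (drop i (idx n)))) (idx n)
           ≡⟨ List.concatMap-cong (λ i → trans (map-pair suc i _) (cong (map (suc i ,_)) (sym (List.drop-map i (idx n))))) (idx n) ⟩
         concatMap (λ i → map (suc i ,_) (drop i (map suc (idx n)))) (idx n)
           ≡⟨ List.concatMap-map _ suc (idx n) ⟨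
         concatMap (λ i → map (i ,_) (drop i (1 ∷ map suc (idx n)))) (map suc (idx n))
           ∎) ⟩
  concatMap (λ i → map (i ,_) (drop i (1 ∷ map suc (idx n)))) (1 ∷ map suc (idx n))
    ≡⟨ cong (λ is → concatMap (λ i → map (i ,_) (drop i is)) is) (idx-suc n) ⟨
  concatMap (λ i → map (i ,_) (drop i (idx (suc n)))) (idx (suc n))
    ∎
  where open ≡-Reasoning

pairs≡pairsOf : ∀ n → pairs n ≡ pairsOf (idx n)
pairs≡pairsOf n = trans (List.concatMap-cong (λ i → cong (map (i ,_)) (idx-drop n i)) (idx n)) (sym (pairsOf-idx n))

map-at-pairs : (x : Vec ℤ m) → map (map× (at x) (at x)) (pairs m) ≡ pairsOf (toList x)
map-at-pairs {m} x = trans (cong (map (map× (at x) (at x))) (pairs≡pairsOf m))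
  (trans (map-pairsOf (at x) (idx m)) (cong pairsOf (sym (toList≡map-at x))))

notMinusOne : ℤ → Bool
notMinusOne e = not (e ==ℤ -[1+ 0 ])

negative : ℤ → Bool
negative e = e <ℤ + 0

differentAbs : ℤ → ℤ → Bool
differentAbs a b = not (∣ a ∣ ≡ᵇ ∣ b ∣)

sumNegative : ℤ → ℤ → Bool
sumNegative a b = (a +ℤ b) <ℤ + 0

headAvoidsMinusOne : ℕ → List ℤ → Bool
headAvoidsMinusOne d xs = all notMinusOne (take d xs)

distinctAbs : List ℤ → Bool
distinctAbs xs = all (uncurry differentAbs) (pairsOf xs)

pairTally : (ℤ → ℤ → Bool) → List ℤ → ℕ
pairTally R xs = tally (uncurry R) (pairsOf xs)

tailNegatives : ℕ → List ℤ → ℕ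
tailNegatives d xs = tally negative (drop d xs)

differentAbs-sym : ∀ a b → differentAbs a b ≡ differentAbs b a
differentAbs-sym a b = cong not (≡ᵇ-sym ∣ a ∣ ∣ b ∣)

-- isM is built from a function `all?` local to its definition; as in at≡foldr,
-- all-universal identifies it once the lists (and _∧_) are abstracted.
isM≡all : ∀ p k (x : Vec ℤ p) → isM p k x ≡
  all (notMinusOne ∘ at x) (filter (λ i → T? (i ≤ᵇ (p ∸ k))) (idx p)) ∧ all (uncurry differentAbs ∘ map× (at x) (at x)) (pairs p)
isM≡all p k x
  with filter (λ i → T? (i ≤ᵇ (p ∸ k))) (idx p) | pairs p | _∧_
     | all-universal (notMinusOne ∘ at x) _ refl (λ _ _ → refl)
     | all-universal (uncurry differentAbs ∘ map× (at x) (at x)) _ refl (λ _ _ → refl)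
... | heads | ps | _&_ | search₁ | search₂ = cong₂ _&_ (search₁ heads) (search₂ ps)

isM-toList : ∀ p k (x : Vec ℤ p) → isM p k x ≡ headAvoidsMinusOne (p ∸ k) (toList x) ∧ distinctAbs (toList x)
isM-toList p k x = trans (isM≡all p k x) (cong₂ _∧_
  (trans (sym (all-map notMinusOne (at x) (filter (λ i → T? (i ≤ᵇ (p ∸ k))) (idx p)))) (cong (all notMinusOne) (map-at-take x (p ∸ k))))
  (trans (sym (all-map (uncurry differentAbs) (map× (at x) (at x)) (pairs p))) (cong (all (uncurry differentAbs)) (map-at-pairs x))))

rk-toList : ∀ p k (x : Vec ℤ p) →
  rk p k x ≡ pairTally _<ℤ_ (toList x) + pairTally sumNegative (toList x) + tailNegatives (p ∸ k) (toList x)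
rk-toList p k x = cong₂ _+_ (cong₂ _+_ (pairs-part _<ℤ_) (pairs-part sumNegative))
  (trans (count-map negative (at x) (filter (λ i → T? (suc (p ∸ k) ≤ᵇ i)) (idx p))) (cong (tally negative) (map-at-drop x (p ∸ k))))
  where
  pairs-part : (R : ℤ → ℤ → Bool) → count (uncurry R ∘ map× (at x) (at x)) (pairs p) ≡ pairTally R (toList x)
  pairs-part R = trans (count-map (uncurry R) _ (pairs p)) (cong (tally (uncurry R)) (map-at-pairs x))

all-pairsOf-∷ : (R : A → A → Bool) (a : A) (as : List A) → all (uncurry R) (pairsOf (a ∷ as)) ≡ all (R a) as ∧ all (uncurry R) (pairsOf as)
all-pairsOf-∷ R a as = trans (all-++ (uncurry R) (map (a ,_) as) (pairsOf as)) (cong (_∧ _) (all-map (uncurry R) (a ,_) as))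

tally-pairsOf-∷ : (R : A → A → Bool) (a : A) (as : List A) → tally (uncurry R) (pairsOf (a ∷ as)) ≡ tally (R a) as + tally (uncurry R) (pairsOf as)
tally-pairsOf-∷ R a as = trans (tally-++ (uncurry R) (map (a ,_) as) (pairsOf as)) (cong (_+ _) (tally-map (uncurry R) (a ,_) as))

all-insertAt : (P : A → Bool) (y : Vec A m) (j : Fin (suc m)) (v : A) → all P (toList (insertAt y j v)) ≡ P v ∧ all P (toList y)
all-insertAt P y       Fin.zero    v = refl
all-insertAt P (h ∷ y) (Fin.suc j) v = trans (cong (P h ∧_) (all-insertAt P y j v)) (∧-swap (P h) (P v) _)

all-take-insertAt : (P : A → Bool) (d : ℕ) (y : Vec A m) (j : Fin (suc m)) (v : A) → toℕ j ≤ d →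
  all P (take (suc d) (toList (insertAt y j v))) ≡ P v ∧ all P (take d (toList y))
all-take-insertAt P d       y       Fin.zero    v _         = refl
all-take-insertAt P (suc d) (h ∷ y) (Fin.suc j) v (s≤s j≤d) =
  trans (cong (P h ∧_) (all-take-insertAt P d y j v j≤d)) (∧-swap (P h) (P v) _)

take-insertAt : (d : ℕ) (y : Vec A m) (j : Fin (suc m)) (v : A) → d ≤ toℕ j → take d (toList (insertAt y j v)) ≡ take d (toList y)
take-insertAt zero    y       j           v _         = refl
take-insertAt (suc d) (h ∷ y) (Fin.suc j) v (s≤s d≤j) = cong (h ∷_) (take-insertAt d y j v d≤j)

drop-insertAt : (d : ℕ) (y : Vec A m) (j : Fin (suc m)) (v : A) → toℕ j ≤ d → drop (suc d) (toList (insertAt y j v)) ≡ drop d (toList y)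
drop-insertAt d       y       Fin.zero    v _         = refl
drop-insertAt (suc d) (h ∷ y) (Fin.suc j) v (s≤s j≤d) = drop-insertAt d y j v j≤d

tally-drop-insertAt : (P : A → Bool) (d : ℕ) (y : Vec A m) (j : Fin (suc m)) (v : A) → d ≤ toℕ j →
  tally P (drop d (toList (insertAt y j v))) ≡ indicator (P v) + tally P (drop d (toList y))
tally-drop-insertAt P zero    y       Fin.zero    v _         = refl
tally-drop-insertAt P zero    (h ∷ y) (Fin.suc j) v _         =
  trans (cong (_+_ (indicator (P h))) (tally-drop-insertAt P zero y j v z≤n)) (+-swap (indicator (P h)) (indicator (P v)) _)
tally-drop-insertAt P (suc d) (h ∷ y) (Fin.suc j) v (s≤s d≤j) = tally-drop-insertAt P d y j v d≤j

all-pairsOf-insertAt : (R : A → A → Bool) → (∀ a b → R a b ≡ R b a) → (y : Vec A m) (j : Fin (suc m)) (v : A) →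
  all (uncurry R) (pairsOf (toList (insertAt y j v))) ≡ all (R v) (toList y) ∧ all (uncurry R) (pairsOf (toList y))
all-pairsOf-insertAt R sym-R y       Fin.zero    v = all-pairsOf-∷ R v (toList y)
all-pairsOf-insertAt R sym-R (h ∷ y) (Fin.suc j) v = begin
  all (uncurry R) (pairsOf (h ∷ toList (insertAt y j v)))
    ≡⟨ all-pairsOf-∷ R h (toList (insertAt y j v)) ⟩
  all (R h) (toList (insertAt y j v)) ∧ all (uncurry R) (pairsOf (toList (insertAt y j v)))
    ≡⟨ cong₂ _∧_ (all-insertAt (R h) y j v) (all-pairsOf-insertAt R sym-R y j v) ⟩
  (R h v ∧ all (R h) (toList y)) ∧ (all (R v) (toList y) ∧ all (uncurry R) (pairsOf (toList y)))
    ≡⟨ ∧-interchange (R h v) _ _ _ ⟩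
  (R h v ∧ all (R v) (toList y)) ∧ (all (R h) (toList y) ∧ all (uncurry R) (pairsOf (toList y)))
    ≡⟨ cong₂ _∧_ (cong (_∧ all (R v) (toList y)) (sym-R h v)) (sym (all-pairsOf-∷ R h (toList y))) ⟩
  all (R v) (h ∷ toList y) ∧ all (uncurry R) (pairsOf (h ∷ toList y))
    ∎
  where open ≡-Reasoning

insertionCost : Bool → Bool → Fin (suc m) → ℕ
insertionCost {m} a b j = toℕ j * indicator a + (m ∸ toℕ j) * indicator b

tally-pairsOf-insertAt : (R : A → A → Bool) {a b : Bool} (y : Vec A m) (j : Fin (suc m)) (v : A) →
  All (λ e → R e v ≡ a × R v e ≡ b) (toList y) →
  tally (uncurry R) (pairsOf (toList (insertAt y j v))) ≡ insertionCost a b j + tally (uncurry R) (pairsOf (toList y))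
tally-pairsOf-insertAt R {b = b} y Fin.zero v hs =
  trans (tally-pairsOf-∷ R v (toList y))
        (cong (_+ _) (trans (tally-const (All.map proj₂ hs)) (cong (_* indicator b) (length-toList y))))
tally-pairsOf-insertAt R {a} {b} (h ∷ y) (Fin.suc j) v ((Rhv , _) ∷ hs) = begin
  tally (uncurry R) (pairsOf (h ∷ toList (insertAt y j v)))
    ≡⟨ tally-pairsOf-∷ R h (toList (insertAt y j v)) ⟩
  tally (R h) (toList (insertAt y j v)) + tally (uncurry R) (pairsOf (toList (insertAt y j v)))
    ≡⟨ cong₂ _+_ (tally-drop-insertAt (R h) 0 y j v z≤n) (tally-pairsOf-insertAt R y j v hs) ⟩
  (indicator (R h v) + tally (R h) (toList y)) + (insertionCost a b j + tally (uncurry R) (pairsOf (toList y)))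
    ≡⟨ cong (λ c → (indicator c + _) + (insertionCost a b j + _)) Rhv ⟩
  (indicator a + tally (R h) (toList y)) + (insertionCost a b j + tally (uncurry R) (pairsOf (toList y)))
    ≡⟨ rearrange (indicator a) _ (toℕ j) (_ ∸ toℕ j) (indicator b) _ ⟩
  insertionCost a b (Fin.suc j) + (tally (R h) (toList y) + tally (uncurry R) (pairsOf (toList y)))
    ≡⟨ cong (_+_ (insertionCost a b (Fin.suc j))) (tally-pairsOf-∷ R h (toList y)) ⟨
  insertionCost a b (Fin.suc j) + tally (uncurry R) (pairsOf (h ∷ toList y))
    ∎
  where
  open ≡-Reasoning
  rearrange : ∀ α x t s β z → (α + x) + ((t * α + s * β) + z) ≡ ((α + t * α) + s * β) + (x + z)
  rearrange = solve-∀

isM-insertAt : ∀ {q} k (j : Fin (suc q)) v (y : Vec ℤ q) → isM (suc q) k (insertAt y j v) ≡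
  all (differentAbs v) (toList y) ∧ (headAvoidsMinusOne (suc q ∸ k) (toList (insertAt y j v)) ∧ distinctAbs (toList y))
isM-insertAt {q} k j v y = trans (isM-toList (suc q) k (insertAt y j v))
  (trans (cong (headAvoidsMinusOne (suc q ∸ k) (toList (insertAt y j v)) ∧_) (all-pairsOf-insertAt differentAbs differentAbs-sym y j v))
         (∧-swap (headAvoidsMinusOne (suc q ∸ k) (toList (insertAt y j v))) (all (differentAbs v) (toList y)) (distinctAbs (toList y))))

rk-insertAt : ∀ {q} k k′ (j : Fin (suc q)) v (y : Vec ℤ q) {a₁ b₁ a₂ b₂ c} →
  All (λ e → ((e <ℤ v) ≡ a₁ × (v <ℤ e) ≡ b₁) × (sumNegative e v ≡ a₂ × sumNegative v e ≡ b₂)) (toList y) →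
  tailNegatives (suc q ∸ k) (toList (insertAt y j v)) ≡ c + tailNegatives (q ∸ k′) (toList y) →
  rk (suc q) k (insertAt y j v) ≡ (insertionCost a₁ b₁ j + insertionCost a₂ b₂ j + c) + rk q k′ y
rk-insertAt {q} k k′ j v y {a₁} {b₁} {a₂} {b₂} {c} hs tail = begin
  rk (suc q) k x
    ≡⟨ rk-toList (suc q) k x ⟩
  pairTally _<ℤ_ (toList x) + pairTally sumNegative (toList x) + tailNegatives (suc q ∸ k) (toList x)
    ≡⟨ cong₂ _+_ (cong₂ _+_ (tally-pairsOf-insertAt _<ℤ_ y j v (All.map proj₁ hs))
                            (tally-pairsOf-insertAt sumNegative y j v (All.map proj₂ hs))) tail ⟩
  (cost₁ + pairTally _<ℤ_ (toList y)) + (cost₂ + pairTally sumNegative (toList y)) + (c + tailNegatives (q ∸ k′) (toList y))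
    ≡⟨ rearrange cost₁ _ cost₂ _ c _ ⟩
  (cost₁ + cost₂ + c) + (pairTally _<ℤ_ (toList y) + pairTally sumNegative (toList y) + tailNegatives (q ∸ k′) (toList y))
    ≡⟨ cong (_+_ (cost₁ + cost₂ + c)) (rk-toList q k′ y) ⟨
  (cost₁ + cost₂ + c) + rk q k′ y
    ∎
  where
  open ≡-Reasoning
  x : Vec ℤ (suc q)
  x = insertAt y j v
  cost₁ cost₂ : ℕ
  cost₁ = insertionCost a₁ b₁ j
  cost₂ = insertionCost a₂ b₂ j
  rearrange : ∀ c₁ l c₂ s c n → (c₁ + l) + (c₂ + s) + (c + n) ≡ (c₁ + c₂ + c) + (l + s + n)
  rearrange = solve-∀

bounded⇒between : ∀ {q} e → ∣ e ∣ ≤ q → -[1+ q ] ℤ.< e × e ℤ.< + suc q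
bounded⇒between (+ n)    n≤q = ℤ.-<+ , ℤ.+<+ (s≤s n≤q)
bounded⇒between -[1+ n ] n<q = ℤ.-<- n<q , ℤ.-<+

comparisons-max : ∀ {v e} → - v ℤ.< e × e ℤ.< v →
  ((e <ℤ v) ≡ true × (v <ℤ e) ≡ false) × (sumNegative e v ≡ false × sumNegative v e ≡ false)
comparisons-max {v} {e} (-v<e , e<v) =
  (<⇒<ℤ≡true e<v , ≮⇒<ℤ≡false (ℤₚ.<-asym e<v)) ,
  (≮⇒<ℤ≡false (ℤₚ.<-asym 0<e+v) , ≮⇒<ℤ≡false (ℤₚ.<-asym (subst (+ 0 ℤ.<_) (ℤₚ.+-comm e v) 0<e+v)))
  where
  0<e+v : + 0 ℤ.< e +ℤ v
  0<e+v = subst (ℤ._< e +ℤ v) (ℤₚ.+-inverseˡ v) (ℤₚ.+-monoˡ-< v -v<e)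

comparisons-min : ∀ {v e} → - v ℤ.< e × e ℤ.< v →
  ((e <ℤ - v) ≡ false × (- v <ℤ e) ≡ true) × (sumNegative e (- v) ≡ true × sumNegative (- v) e ≡ true)
comparisons-min {v} {e} (-v<e , e<v) =
  (≮⇒<ℤ≡false (ℤₚ.<-asym -v<e) , <⇒<ℤ≡true -v<e) ,
  (<⇒<ℤ≡true e-v<0 , <⇒<ℤ≡true (subst (ℤ._< + 0) (ℤₚ.+-comm e (- v)) e-v<0))
  where
  e-v<0 : e +ℤ - v ℤ.< + 0
  e-v<0 = subst (e +ℤ - v ℤ.<_) (ℤₚ.+-inverseʳ v) (ℤₚ.+-monoˡ-< (- v) e<v)

-- The first q+1 ∸ k coordinates of x ∈ ℤ^(q+1) must avoid -1, the others carry the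
-- hyperplanes x_i = 0. Inserting v at j turns this split of x into the split of y at
-- q ∸ k′, adding c to the number of negative coordinates of the second part.
SplitShift : (q k k′ : ℕ) → Fin (suc q) → ℤ → ℕ → Set
SplitShift q k k′ j v c = ∀ (y : Vec ℤ q) →
    headAvoidsMinusOne (suc q ∸ k) (toList (insertAt y j v)) ≡ headAvoidsMinusOne (q ∸ k′) (toList y)
  × tailNegatives (suc q ∸ k) (toList (insertAt y j v)) ≡ c + tailNegatives (q ∸ k′) (toList y)

splitShift-head : ∀ {q k} {j : Fin (suc q)} {v} → toℕ j < suc q ∸ k → notMinusOne v ≡ true → SplitShift q k k j v 0
splitShift-head {q} {k} {j} {v} j<d v≢-1 y =
  trans (cong (λ d → headAvoidsMinusOne d (toList (insertAt y j v))) d≡)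
        (trans (all-take-insertAt notMinusOne (q ∸ k) y j v j≤d) (cong (_∧ headAvoidsMinusOne (q ∸ k) (toList y)) v≢-1)) ,
  trans (cong (λ d → tailNegatives d (toList (insertAt y j v))) d≡) (cong (tally negative) (drop-insertAt (q ∸ k) y j v j≤d))
  where
  d≡ : suc q ∸ k ≡ suc (q ∸ k)
  d≡ = ℕ.+-∸-assoc 1 {q} {k} (s≤s⁻¹ (ℕ.m∸n≢0⇒n<m (λ d≡0 → ℕ.n≮0 (subst (toℕ j <_) d≡0 j<d))))
  j≤d : toℕ j ≤ q ∸ k
  j≤d = s≤s⁻¹ (subst (toℕ j <_) d≡ j<d)

splitShift-tail : ∀ {q k′} {j : Fin (suc q)} {v} → q ∸ k′ ≤ toℕ j → SplitShift q (suc k′) k′ j v (indicator (negative v))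
splitShift-tail {q} {k′} {j} {v} d≤j y =
  cong (all notMinusOne) (take-insertAt (q ∸ k′) y j v d≤j) , tally-drop-insertAt negative (q ∸ k′) y j v d≤j

tally-allVecs-suc : (F : Vec ℤ (suc m) → Bool) (vs : List ℤ) →
  tally F (allVecs (suc m) vs) ≡ sum (map (λ v → tally (F ∘ (v ∷_)) (allVecs m vs)) vs)
tally-allVecs-suc {m} F vs = trans (tally-concatMap F (λ v → map (v ∷_) (allVecs m vs)) vs)
  (cong sum (List.map-cong (λ v → tally-map F (v ∷_) (allVecs m vs)) vs))

tally-lookup-insertAt : (j : Fin (suc m)) {v : ℤ} {vs : List ℤ} → tally (_==ℤ v) vs ≡ 1 → (F : Vec ℤ (suc m) → Bool) →
  tally (λ x → (lookup x j ==ℤ v) ∧ F x) (allVecs (suc m) vs) ≡ tally (λ y → F (insertAt y j v)) (allVecs m vs)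
tally-lookup-insertAt {m} Fin.zero {v} {vs} once F = begin
  tally (λ x → (lookup x Fin.zero ==ℤ v) ∧ F x) (allVecs (suc m) vs)
    ≡⟨ tally-allVecs-suc _ vs ⟩
  sum (map (λ w → tally (λ y → (w ==ℤ v) ∧ F (w ∷ y)) (allVecs m vs)) vs)
    ≡⟨ cong sum (List.map-cong select vs) ⟩
  sum (map (λ w → if w ==ℤ v then C else 0) vs)
    ≡⟨ sum-map-if (_==ℤ v) C vs ⟩
  tally (_==ℤ v) vs * C
    ≡⟨ cong (_* C) once ⟩
  1 * C
    ≡⟨ ℕ.*-identityˡ C ⟩
  C ∎
  where
  open ≡-Reasoning
  C : ℕ
  C = tally (λ y → F (v ∷ y)) (allVecs m vs)
  select : ∀ w → tally (λ y → (w ==ℤ v) ∧ F (w ∷ y)) (allVecs m vs) ≡ (if w ==ℤ v then C else 0)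
  select w with w ==ℤ v in w==v
  ... | true  = cong (λ u → tally (λ y → F (u ∷ y)) (allVecs m vs)) (==ℤ⇒≡ w==v)
  ... | false = tally-false (All.universal (λ _ → refl) (allVecs m vs))
tally-lookup-insertAt {suc m} (Fin.suc j) {v} {vs} once F = begin
  tally (λ x → (lookup x (Fin.suc j) ==ℤ v) ∧ F x) (allVecs (suc (suc m)) vs)
    ≡⟨ tally-allVecs-suc _ vs ⟩
  sum (map (λ w → tally (λ x → (lookup x j ==ℤ v) ∧ F (w ∷ x)) (allVecs (suc m) vs)) vs)
    ≡⟨ cong sum (List.map-cong (λ w → tally-lookup-insertAt j once (F ∘ (w ∷_))) vs) ⟩
  sum (map (λ w → tally (λ y → F (w ∷ insertAt y j v)) (allVecs m vs)) vs)
    ≡⟨ tally-allVecs-suc _ vs ⟨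
  tally (λ y → F (insertAt y (Fin.suc j) v)) (allVecs (suc m) vs)
    ∎
  where open ≡-Reasoning

tally-allVecs-all : ∀ m (Q : ℤ → Bool) (vs : List ℤ) (G : Vec ℤ m → Bool) →
  tally (λ y → all Q (toList y) ∧ G y) (allVecs m vs) ≡ tally G (allVecs m (filter (T? ∘ Q) vs))
tally-allVecs-all zero    Q vs G = refl
tally-allVecs-all (suc m) Q vs G = begin
  tally (λ y → all Q (toList y) ∧ G y) (allVecs (suc m) vs)
    ≡⟨ tally-allVecs-suc _ vs ⟩
  sum (map (λ w → tally (λ y → (Q w ∧ all Q (toList y)) ∧ G (w ∷ y)) (allVecs m vs)) vs)
    ≡⟨ cong sum (List.map-cong select vs) ⟩
  sum (map (λ w → if Q w then tally (G ∘ (w ∷_)) (allVecs m (filter (T? ∘ Q) vs)) else 0) vs)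
    ≡⟨ sum-map-filter Q _ vs ⟨
  sum (map (λ w → tally (G ∘ (w ∷_)) (allVecs m (filter (T? ∘ Q) vs))) (filter (T? ∘ Q) vs))
    ≡⟨ tally-allVecs-suc G (filter (T? ∘ Q) vs) ⟨
  tally G (allVecs (suc m) (filter (T? ∘ Q) vs))
    ∎
  where
  open ≡-Reasoning
  select : ∀ w → tally (λ y → (Q w ∧ all Q (toList y)) ∧ G (w ∷ y)) (allVecs m vs)
                 ≡ (if Q w then tally (G ∘ (w ∷_)) (allVecs m (filter (T? ∘ Q) vs)) else 0)
  select w with Q w
  ... | true  = tally-allVecs-all m Q vs (G ∘ (w ∷_))
  ... | false = tally-false (All.universal (λ _ → refl) (allVecs m vs))

allVecs-All : ∀ m {P : ℤ → Set} {vs : List ℤ} → All P vs → All (All P ∘ toList) (allVecs m vs)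
allVecs-All zero    ps = [] ∷ []
allVecs-All (suc m) ps = All.concat⁺ (All.map⁺ (All.map (λ pw → All.map⁺ (All.map (pw ∷_) (allVecs-All m ps))) ps))

upTo-below : ∀ q → All (_< q) (upTo q)
upTo-below q = All.applyUpTo⁺₁ id q (λ i<q → i<q)

vals-bounded : ∀ q → All (λ e → ∣ e ∣ ≤ q) (vals q)
vals-bounded q = All.++⁺ (All.map⁺ (upTo-below q)) (All.map⁺ (upTo-below q))

vals-suc : ∀ q → vals (suc q) ≡ (map (λ n → + suc n) (upTo q) ++ [ + suc q ]) ++ (map -[1+_] (upTo q) ++ [ -[1+ q ] ])
vals-suc q = cong₂ _++_ (snoc (λ n → + suc n)) (snoc -[1+_])
  where
  snoc : (f : ℕ → ℤ) → map f (upTo (suc q)) ≡ map f (upTo q) ++ [ f q ]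
  snoc f = trans (cong (map f) (sym (List.upTo-∷ʳ q))) (List.map-++ f (upTo q) [ q ])

filter-vals : ∀ q → filter (T? ∘ differentAbs (+ suc q)) (vals (suc q)) ≡ vals q
filter-vals q = trans (cong (filter Q?) (vals-suc q))
  (trans (List.filter-++ Q? (map (λ n → + suc n) (upTo q) ++ [ + suc q ]) (map -[1+_] (upTo q) ++ [ -[1+ q ] ]))
         (cong₂ _++_ (without-last _ (+ suc q) (All.map⁺ (upTo-below q)) refl)
                     (without-last _ -[1+ q ] (All.map⁺ (upTo-below q)) refl)))
  where
  Q? : (e : ℤ) → Dec (T (differentAbs (+ suc q) e))
  Q? = T? ∘ differentAbs (+ suc q)
  keep : ∀ {e} → ∣ e ∣ ≤ q → T (differentAbs (+ suc q) e)
  keep {e} ∣e∣≤q = subst (T ∘ not) (sym (≢⇒≡ᵇ≡false {suc q} {∣ e ∣} (λ q+1≡∣e∣ → ℕ.1+n≰n (subst (_≤ q) (sym q+1≡∣e∣) ∣e∣≤q)))) tt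
  without-last : ∀ xs x → All (λ e → ∣ e ∣ ≤ q) xs → ∣ x ∣ ≡ suc q → filter Q? (xs ++ [ x ]) ≡ xs
  without-last xs x bounded ∣x∣ =
    trans (List.filter-++ Q? xs [ x ])
      (trans (cong₂ _++_ (List.filter-all Q? (All.map (λ {e} → keep {e}) bounded)) (List.filter-reject Q? {x} {[]} reject))
             (List.++-identityʳ xs))
    where
    reject : ¬ T (differentAbs (+ suc q) x)
    reject = subst (T ∘ not) (trans (cong (suc q ≡ᵇ_) ∣x∣) (≡ᵇ-refl (suc q)))

tally-vals-suc : ∀ q (P : ℤ → Bool) → tally P (vals (suc q)) ≡ tally P (vals q) + (indicator (P (+ suc q)) + indicator (P -[1+ q ]))
tally-vals-suc q P = begin
  tally P (vals (suc q))
    ≡⟨ cong (tally P) (vals-suc q) ⟩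
  tally P ((pos ++ [ + suc q ]) ++ (neg ++ [ -[1+ q ] ]))
    ≡⟨ tally-++ P (pos ++ [ + suc q ]) (neg ++ [ -[1+ q ] ]) ⟩
  tally P (pos ++ [ + suc q ]) + tally P (neg ++ [ -[1+ q ] ])
    ≡⟨ cong₂ _+_ (tally-++ P pos [ + suc q ]) (tally-++ P neg [ -[1+ q ] ]) ⟩
  (tally P pos + (indicator (P (+ suc q)) + 0)) + (tally P neg + (indicator (P -[1+ q ]) + 0))
    ≡⟨ rearrange (tally P pos) _ (tally P neg) _ ⟩
  (tally P pos + tally P neg) + (indicator (P (+ suc q)) + indicator (P -[1+ q ]))
    ≡⟨ cong (_+ (indicator (P (+ suc q)) + indicator (P -[1+ q ]))) (tally-++ P pos neg) ⟨
  tally P (vals q) + (indicator (P (+ suc q)) + indicator (P -[1+ q ]))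
    ∎
  where
  open ≡-Reasoning
  pos neg : List ℤ
  pos = map (λ n → + suc n) (upTo q)
  neg = map -[1+_] (upTo q)
  rearrange : ∀ a x b y → (a + (x + 0)) + (b + (y + 0)) ≡ (a + b) + (x + y)
  rearrange = solve-∀

vals-unique : ∀ {q v} → ∣ v ∣ ≡ suc q → tally (_==ℤ v) (vals (suc q)) ≡ 1
vals-unique {q} {v} ∣v∣ = trans (tally-vals-suc q (_==ℤ v))
  (cong₂ _+_ (tally-false (All.map (λ {e} → differs {e}) (vals-bounded q))) (ends v ∣v∣))
  where
  differs : ∀ {e} → ∣ e ∣ ≤ q → (e ==ℤ v) ≡ false
  differs ∣e∣≤q = ≢⇒==ℤ≡false (λ e≡v → ℕ.1+n≰n (subst (_≤ q) (trans (cong ∣_∣ e≡v) ∣v∣) ∣e∣≤q))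
  ends : ∀ w → ∣ w ∣ ≡ suc q → indicator (+ suc q ==ℤ w) + indicator (-[1+ q ] ==ℤ w) ≡ 1
  ends (+ _)    refl = cong (λ b → indicator b + 0) (==ℤ-refl (+ suc q))
  ends -[1+ _ ] refl = cong indicator (==ℤ-refl -[1+ q ])

restricted≡tally : ∀ p k (j : Fin p) v r →
  restricted p k (suc (toℕ j)) v r ≡ tally (λ x → (lookup x j ==ℤ v) ∧ (isM p k x ∧ (rk p k x ≡ᵇ r))) (allVecs p (vals p))
restricted≡tally p k j v r =
  trans (count≡tally _ (filter (λ x → T? (at x (suc (toℕ j)) ==ℤ v)) (M p k)))
  (trans (tally-filter (λ x → at x (suc (toℕ j)) ==ℤ v) _ (M p k))
  (trans (tally-filter (isM p k) _ (allVecs p (vals p)))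
         (tally-cong (All.universal reorder (allVecs p (vals p))))))
  where
  reorder : ∀ x → isM p k x ∧ ((at x (suc (toℕ j)) ==ℤ v) ∧ (rk p k x ≡ᵇ r)) ≡ (lookup x j ==ℤ v) ∧ (isM p k x ∧ (rk p k x ≡ᵇ r))
  reorder x = trans (∧-swap (isM p k x) (at x (suc (toℕ j)) ==ℤ v) (rk p k x ≡ᵇ r)) (cong (λ e → (e ==ℤ v) ∧ (isM p k x ∧ (rk p k x ≡ᵇ r))) (at-lookup x j))

genPoly-M≡tally : ∀ q k (f : Vec ℤ q → ℕ) r → genPoly f (M q k) r ≡ tally (λ y → isM q k y ∧ (f y ≡ᵇ r)) (allVecs q (vals q))
genPoly-M≡tally q k f r = trans (count≡tally _ (M q k)) (tally-filter (isM q k) _ (allVecs q (vals q)))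

restricted-insertAt : ∀ {q} k k′ c (j : Fin (suc q)) v → ∣ v ∣ ≡ suc q →
  (∀ y → headAvoidsMinusOne (suc q ∸ k) (toList (insertAt y j v)) ≡ headAvoidsMinusOne (q ∸ k′) (toList y)) →
  (∀ y → All (λ e → ∣ e ∣ ≤ q) (toList y) → rk (suc q) k (insertAt y j v) ≡ c + rk q k′ y) →
  ∀ r → restricted (suc q) k (suc (toℕ j)) v r ≡ shift c (zeta q k′) r
restricted-insertAt {q} k k′ c j v ∣v∣ head≡ rank r = begin
  restricted (suc q) k (suc (toℕ j)) v r
    ≡⟨ restricted≡tally (suc q) k j v r ⟩
  tally (λ x → (lookup x j ==ℤ v) ∧ F x) (allVecs (suc q) (vals (suc q)))
    ≡⟨ tally-lookup-insertAt j (vals-unique ∣v∣) F ⟩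
  tally (F ∘ ins) (allVecs q (vals (suc q)))
    ≡⟨ tally-cong (All.universal split (allVecs q (vals (suc q)))) ⟩
  tally (λ y → all (differentAbs (+ suc q)) (toList y) ∧ G y) (allVecs q (vals (suc q)))
    ≡⟨ tally-allVecs-all q (differentAbs (+ suc q)) (vals (suc q)) G ⟩
  tally G (allVecs q (filter (T? ∘ differentAbs (+ suc q)) (vals (suc q))))
    ≡⟨ cong (tally G ∘ allVecs q) (filter-vals q) ⟩
  tally G (allVecs q (vals q))
    ≡⟨ tally-cong (All.map (λ {y} → reduce y) (allVecs-All q (vals-bounded q))) ⟩
  tally (λ y → isM q k′ y ∧ (c + rk q k′ y ≡ᵇ r)) (allVecs q (vals q))
    ≡⟨ genPoly-M≡tally q k′ (λ y → c + rk q k′ y) r ⟨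
  genPoly (λ y → c + rk q k′ y) (M q k′) r
    ≡⟨ genPoly-+ (rk q k′) (M q k′) c r ⟩
  shift c (zeta q k′) r ∎
  where
  open ≡-Reasoning
  ins : Vec ℤ q → Vec ℤ (suc q)
  ins y = insertAt y j v
  F : Vec ℤ (suc q) → Bool
  F x = isM (suc q) k x ∧ (rk (suc q) k x ≡ᵇ r)
  G : Vec ℤ q → Bool
  G y = (headAvoidsMinusOne (suc q ∸ k) (toList (ins y)) ∧ distinctAbs (toList y)) ∧ (rk (suc q) k (ins y) ≡ᵇ r)
  split : ∀ y → F (ins y) ≡ all (differentAbs (+ suc q)) (toList y) ∧ G y
  split y = trans (cong (_∧ (rk (suc q) k (ins y) ≡ᵇ r)) (isM-insertAt k j v y))
    (trans (Bool.∧-assoc (all (differentAbs v) (toList y)) _ _) (cong (λ n → all (λ e → not (n ≡ᵇ ∣ e ∣)) (toList y) ∧ G y) ∣v∣))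
  reduce : ∀ y → All (λ e → ∣ e ∣ ≤ q) (toList y) → G y ≡ isM q k′ y ∧ (c + rk q k′ y ≡ᵇ r)
  reduce y bounded = cong₂ _∧_
    (trans (cong (_∧ distinctAbs (toList y)) (head≡ y)) (sym (isM-toList q k′ y)))
    (cong (_≡ᵇ r) (rank y bounded))

restricted-max : ∀ {q} k k′ (j : Fin (suc q)) → SplitShift q k k′ j (+ suc q) 0 →
  ∀ r → restricted (suc q) k (suc (toℕ j)) (+ suc q) r ≡ shift (toℕ j) (zeta q k′) r
restricted-max {q} k k′ j split = restricted-insertAt k k′ (toℕ j) j (+ suc q) refl (proj₁ ∘ split) rank
  where
  cost : ∀ t s → t * 1 + s * 0 + (t * 0 + s * 0) + 0 ≡ t
  cost = solve-∀
  rank : ∀ y → All (λ e → ∣ e ∣ ≤ q) (toList y) → rk (suc q) k (insertAt y j (+ suc q)) ≡ toℕ j + rk q k′ y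
  rank y bounded = trans
    (rk-insertAt k k′ j (+ suc q) y (All.map (λ {e} b → comparisons-max (bounded⇒between e b)) bounded) (proj₂ (split y)))
    (cong (_+ rk q k′ y) (cost (toℕ j) (q ∸ toℕ j)))

restricted-min : ∀ {q} k k′ (j : Fin (suc q)) {c} → SplitShift q k k′ j -[1+ q ] c →
  ∀ r → restricted (suc q) k (suc (toℕ j)) -[1+ q ] r ≡ shift (c + (q ∸ toℕ j + q)) (zeta q k′) r
restricted-min {q} k k′ j {c} split = restricted-insertAt k k′ (c + (q ∸ toℕ j + q)) j -[1+ q ] refl (proj₁ ∘ split) rank
  where
  cost : ∀ t s a → t * 0 + s * 1 + (t * 1 + s * 1) + a ≡ a + (s + (t + s))
  cost = solve-∀
  rank : ∀ y → All (λ e → ∣ e ∣ ≤ q) (toList y) → rk (suc q) k (insertAt y j -[1+ q ]) ≡ c + (q ∸ toℕ j + q) + rk q k′ y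
  rank y bounded = trans
    (rk-insertAt k k′ j -[1+ q ] y (All.map (λ {e} b → comparisons-min (bounded⇒between e b)) bounded) (proj₂ (split y)))
    (cong (_+ rk q k′ y) (trans (cost (toℕ j) (q ∸ toℕ j) c)
                                (cong (λ n → c + (q ∸ toℕ j + n)) (ℕ.m+[n∸m]≡n (toℕ≤pred[n] j)))))

2*[1+n]∸[1+m]≡1+[n∸m+n] : ∀ {m n} → m ≤ n → 2 * suc n ∸ suc m ≡ suc (n ∸ m + n)
2*[1+n]∸[1+m]≡1+[n∸m+n] {m} {n} m≤n = begin
  2 * suc n ∸ suc m                      ≡⟨ cong (λ l → 2 * suc l ∸ suc m) m+d≡n ⟨
  2 * suc (m + d) ∸ suc m                ≡⟨ cong (_∸ suc m) (split m d) ⟩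
  suc m + suc (d + (m + d)) ∸ suc m      ≡⟨ ℕ.m+n∸m≡n (suc m) _ ⟩
  suc (d + (m + d))                      ≡⟨ cong (λ l → suc (d + l)) m+d≡n ⟩
  suc (d + n)                            ∎
  where
  open ≡-Reasoning
  d : ℕ
  d = n ∸ m
  m+d≡n : m + d ≡ n
  m+d≡n = ℕ.m+[n∸m]≡n m≤n
  split : ∀ a b → 2 * suc (a + b) ≡ suc a + suc (b + (a + b))
  split = solve-∀

restricted-head : ∀ q k (j : Fin (suc q)) → 1 ≤ q → toℕ j < suc q ∸ k →
    (∀ r → restricted (suc q) k (suc (toℕ j)) (+ suc q) r ≡ shift (toℕ j) (zeta q k) r)
  × (∀ r → restricted (suc q) k (suc (toℕ j)) -[1+ q ] r ≡ shift (2 * suc q ∸ suc (toℕ j) ∸ 1) (zeta q k) r)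
restricted-head q k j (s≤s z≤n) j<d =
  restricted-max k k j (splitShift-head {q} {k} {j} {+ suc q} j<d refl) ,
  λ r → trans (restricted-min k k j (splitShift-head {q} {k} {j} { -[1+ q ]} j<d refl) r)
              (cong (λ c → shift c (zeta q k) r) (sym (cong (_∸ 1) (2*[1+n]∸[1+m]≡1+[n∸m+n] (toℕ≤pred[n] j)))))

restricted-tail : ∀ q k (j : Fin (suc q)) → suc q ∸ k < suc (toℕ j) →
    (∀ r → restricted (suc q) k (suc (toℕ j)) (+ suc q) r ≡ shift (toℕ j) (zeta q (k ∸ 1)) r)
  × (∀ r → restricted (suc q) k (suc (toℕ j)) -[1+ q ] r ≡ shift (2 * suc q ∸ suc (toℕ j)) (zeta q (k ∸ 1)) r)
restricted-tail q zero     j p<j+1 = contradiction (toℕ<n j) (ℕ.≤⇒≯ (s≤s⁻¹ p<j+1))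
restricted-tail q (suc k′) j d<j+1 =
  restricted-max (suc k′) k′ j (splitShift-tail {q} {k′} {j} {+ suc q} (s≤s⁻¹ d<j+1)) ,
  λ r → trans (restricted-min (suc k′) k′ j (splitShift-tail {q} {k′} {j} { -[1+ q ]} (s≤s⁻¹ d<j+1)) r)
              (cong (λ c → shift c (zeta q k′) r) (sym (2*[1+n]∸[1+m]≡1+[n∸m+n] (toℕ≤pred[n] j))))

lemma3p4 : (p k i : ℕ) → 3 ≤ p → k ≤ p → 1 ≤ i → i ≤ p →
    ((i ≤ p ∸ k →
        (∀ r → restricted p k i (+ p) r ≡ shift (i ∸ 1) (zeta (p ∸ 1) k) r)
      × (∀ r → restricted p k i (- (+ p)) r ≡ shift (2 * p ∸ i ∸ 1) (zeta (p ∸ 1) k) r))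
    × (p ∸ k < i →
        (∀ r → restricted p k i (+ p) r ≡ shift (i ∸ 1) (zeta (p ∸ 1) (k ∸ 1)) r)
      × (∀ r → restricted p k i (- (+ p)) r ≡ shift (2 * p ∸ i) (zeta (p ∸ 1) (k ∸ 1)) r)))
lemma3p4 (suc q) k (suc i) (s≤s 2≤q) _ (s≤s z≤n) i<p with fromℕ< i<p | toℕ-fromℕ< i<p
... | j | refl = restricted-head q k j (ℕ.<⇒≤ 2≤q) , restricted-tail q k j
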